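{- Let $G$ be a finite group and $H$ a connected directed graph with a rotation system, cellularly embedded in the oriented closed surface $S$ determined by the rotation system, with dual $H^*$. For every $G$-flow $\psi$ on $H$, letting $\psi^*(e^*)=\psi(e)$, the pair consisting of the covering $\ell: H^*_{\psi^*} \to H^*$ and the map $\psi^*_\ell = \psi^*\circ \ell$ is a minimal global covering tension on $H^*$. Conversely, every minimal global covering tension $(s: K \to H^*, \phi)$ on $H^*$ yields a $G$-flow on $H$, namely $e \mapsto (\phi\circ s^{ -1})(e^*)$.
   Context: Graphs may have multiple edges and loops. Rotation system: a cyclic order of edge-ends at each vertex (a loop contributes two). Faces: closed walks obtained by face tracing (after entering $w$ along an edge, leave along the next edge-end in the cyclic order at $w$). $G$-flow: listing edge-ends at $v$ cyclically as $e_v^1,\dots,e_v^{d(v)}$ with $\sigma_v=+1$ if the edge enters $v$ and $-1$ if it leaves, a map $\psi: E\to G$ with $\prod_i\psi(e_v^i)^{\sigma_v(e_v^i)}=1$ at every vertex. Dual $H^*$: a vertex per face of $H$, and per edge $e$ of $H$ a dual edge $e^*$ joining the faces on both sides of $e$, directed to cross $e$ from its left side to its right side; $H^*$ carries the rotation system induced by the orientation of $S$. Heights: $h_\phi(W)=\prod_i\phi(e_i)^{\pm1}$, exponent $+1$ iff $e_i$ traversed in its direction. Local $G$-tension: height $1$ on all facial walks; global $G$-tension: height $1$ on all closed walks. Covering $s: K\to L$ ($K$ connected with rotation system): surjective graph homomorphism preserving directions, bijective on edge-ends at each vertex and respecting cyclic orders; $\phi_s=\phi\circ s$. Global covering w.r.t.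 a local tension $\phi$ on $L$: a covering $s$ with $\phi_s$ a global tension; it is minimal if every global covering $r: K'\to L$ w.r.t. $\phi$ ($K'$ connected) factors as $r = s\circ q$ with $q: K'\to K$ a covering. A global covering tension on $L$: a covering $s: K\to L$ and a global $G$-tension $\phi$ on $K$ such that $\phi$ is constant on each fibre $s^{ -1}(e)$ and the induced map $\phi\circ s^{ -1}$ on $E(L)$ is a local $G$-tension; it is minimal if $s$ is a minimal global covering w.r.t. $\phi\circ s^{ -1}$. For $L$ with base vertex $x$ and $\phi: E(L)\to G$, $L_\phi$ has vertices $(e(W),h_\phi(W))$ for walks $W$ from $x$ ($e(W)$ the end vertex), and for each vertex $(a,h)$ and edge $f$ of $L$ directed from $a$ to $b$ an edge $(f,h)$ from $(a,h)$ to $(b,h\phi(f))$, with lifted rotation system; $\ell: L_\phi\to L$ is $(u,h)\mapsto u$, $(f,h)\mapsto f$. -}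

module Defs where

open import Level using (Level)
open import Data.Nat using (ℕ; zero; suc)
open import Data.Fin using (Fin)
open import Data.Product using (Σ; ∃; _×_; _,_; proj₁; proj₂)
open import Relation.Binary.PropositionalEquality using (_≡_; refl; sym; trans; subst; cong)
open import Algebra.Structures using (IsGroup)
open import Function.Bundles using (_↔_)
open import Data.Irrelevant as Irr using (Irrelevant; [_])
open import Data.Refinement using (Refinement; value; proof) renaming (_,_ to ⟨_,_⟩)

Finite : Set → Set
Finite A = Σ ℕ (λ n → Fin n ↔ A)

record Grp : Set₁ where
  infixl 7 _∙_
  infix 8 _⁻¹
  field
    Carrier : Set
    _∙_     : Carrier → Carrier → Carrier
    ε       : Carrier
    _⁻¹     : Carrier → Carrier
    isGroup : IsGroup _≡_ _∙_ ε _⁻¹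

-- Directed graphs (multiple edges and loops allowed) together with a
-- "rotation": a permutation nxt (inverse prv) of the edge-ends.

data Side : Set where
  tailS headS : Side

flipS : Side → Side
flipS tailS = headS
flipS headS = tailS

iter : {A : Set} → (A → A) → ℕ → A → A
iter f zero    a = a
iter f (suc k) a = f (iter f k a)

record Graph : Set₁ where
  field
    V   : Set
    E   : Set
    tl  : E → V
    hd  : E → V
    nxt : E × Side → E × Side
    prv : E × Side → E × Side

  End : Set
  End = E × Side

  endV : End → V
  endV (e , tailS) = tl e
  endV (e , headS) = hd e

  opp : End → End
  opp (e , s) = (e , flipS s)

  -- face tracing: leaving along edge-end d, arrive at the other end of
  -- its edge and leave along the next edge-end in the cyclic order there
  fstep : End → End
  fstep d = nxt (opp d)

  fstep⁻¹ : End → End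
  fstep⁻¹ d = opp (prv d)

open Graph public

record IsRot (G : Graph) : Set where
  field
    nxt-prv : ∀ d → nxt G (prv G d) ≡ d
    prv-nxt : ∀ d → prv G (nxt G d) ≡ d
    nxt-at  : ∀ d → endV G (nxt G d) ≡ endV G d
    cyclic  : ∀ d d' → endV G d ≡ endV G d' → ∃ λ k → iter (nxt G) k d ≡ d'
open IsRot public

prv-at : (G : Graph) → IsRot G → ∀ d → endV G (prv G d) ≡ endV G d
prv-at G r d = trans (sym (nxt-at r (prv G d))) (cong (endV G) (nxt-prv r d))

data Walk (G : Graph) : V G → V G → Set where
  []  : ∀ {v} → Walk G v v
  fwd : ∀ {w} (e : E G) → Walk G (hd G e) w → Walk G (tl G e) w
  bwd : ∀ {w} (e : E G) → Walk G (tl G e) w → Walk G (hd G e) w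

Connected : Graph → Set
Connected G = ∀ u v → Walk G u v

record Hom (K L : Graph) : Set where
  constructor hom
  field
    vm : V K → V L
    em : E K → E L

  endMap : End K → End L
  endMap (e , s) = (em e , s)
open Hom public

record IsCovering (K L : Graph) (s : Hom K L) : Set where
  field
    tl-pres : ∀ e → tl L (em s e) ≡ vm s (tl K e)
    hd-pres : ∀ e → hd L (em s e) ≡ vm s (hd K e)
    surjV   : ∀ v → ∃ λ u → vm s u ≡ v
    surjE   : ∀ f → ∃ λ e → em s e ≡ f
    ends-inj  : ∀ d d' → endV K d ≡ endV K d' → endMap s d ≡ endMap s d' → d ≡ d'
    ends-surj : ∀ u d' → endV L d' ≡ vm s u →
                ∃ λ d → (endV K d ≡ u) × (endMap s d ≡ d')
    rot-pres  : ∀ d → endMap s (nxt K d) ≡ nxt L (endMap s d)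
open IsCovering public

module _ (𝔾 : Grp) where
  open Grp 𝔾

  -- contribution of an edge-end traversed when leaving along it
  dartVal : (G : Graph) → (E G → Carrier) → End G → Carrier
  dartVal G φ (e , tailS) = φ e
  dartVal G φ (e , headS) = φ e ⁻¹

  faceHeight : (G : Graph) → (E G → Carrier) → End G → ℕ → Carrier
  faceHeight G φ d zero    = ε
  faceHeight G φ d (suc k) = dartVal G φ d ∙ faceHeight G φ (fstep G d) k

  height : (G : Graph) → (E G → Carrier) → ∀ {u v} → Walk G u v → Carrier
  height G φ []        = ε
  height G φ (fwd e W) = φ e ∙ height G φ W
  height G φ (bwd e W) = φ e ⁻¹ ∙ height G φ W

  LocalTension : (G : Graph) → (E G → Carrier) → Set
  LocalTension G φ = ∀ d k → iter (fstep G) (suc k) d ≡ d → faceHeight G φ d (suc k) ≡ ε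

  GlobalTension : (G : Graph) → (E G → Carrier) → Set
  GlobalTension G φ = ∀ v (W : Walk G v v) → height G φ W ≡ ε

  -- G-flows: product over the cyclic order of edge-ends at a vertex,
  -- exponent +1 for entering (head end), -1 for leaving (tail end)
  flowVal : (G : Graph) → (E G → Carrier) → End G → Carrier
  flowVal G ψ (e , headS) = ψ e
  flowVal G ψ (e , tailS) = ψ e ⁻¹

  rotProd : (G : Graph) → (E G → Carrier) → End G → ℕ → Carrier
  rotProd G ψ d zero    = ε
  rotProd G ψ d (suc k) = flowVal G ψ d ∙ rotProd G ψ (nxt G d) k

  IsFlow : (G : Graph) → (E G → Carrier) → Set
  IsFlow G ψ = ∀ d k → iter (nxt G) (suc k) d ≡ d → rotProd G ψ d (suc k) ≡ ε

  induced : {K L : Graph} {s : Hom K L} → IsCovering K L s →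
            (E K → Carrier) → E L → Carrier
  induced c φ f = φ (proj₁ (surjE c f))

  record GlobalCovering (L : Graph) (τ : E L → Carrier) (K : Graph) (s : Hom K L) : Set where
    field
      rotK   : IsRot K
      connK  : Connected K
      cov    : IsCovering K L s
      global : GlobalTension K (λ e → τ (em s e))

  record MinimalGlobalCovering (L : Graph) (τ : E L → Carrier) (K : Graph) (s : Hom K L) : Set₁ where
    field
      isGlobal  : GlobalCovering L τ K s
      factorize : ∀ (K' : Graph) (r : Hom K' L) → GlobalCovering L τ K' r →
                  ∃ λ (q : Hom K' K) → IsCovering K' K q ×
                    (∀ v → vm r v ≡ vm s (vm q v)) × (∀ e → em r e ≡ em s (em q e))

  record MinimalGlobalCoveringTension (L : Graph) (K : Graph) (s : Hom K L) (φ : E K → Carrier) : Set₁ where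
    field
      rotK    : IsRot K
      connK   : Connected K
      cov     : IsCovering K L s
      global  : GlobalTension K φ
      fibre   : ∀ e e' → em s e ≡ em s e' → φ e ≡ φ e'
      local   : LocalTension L (induced cov φ)
      minimal : MinimalGlobalCovering L (induced cov φ) K s

  module Derived (L : Graph) (rotL : IsRot L) (τ : E L → Carrier) (x : V L) where

    -- (u , g) is reachable iff some walk from x ends at u with height g
    data Reach : V L → Carrier → Set where
      base  : Reach x ε
      stepF : ∀ {g} f → Reach (tl L f) g → Reach (hd L f) (g ∙ τ f)
      stepB : ∀ {g} f → Reach (hd L f) g → Reach (tl L f) (g ∙ τ f ⁻¹)

    LV : Set
    LV = Refinement (V L × Carrier) (λ p → Reach (proj₁ p) (proj₂ p))

    -- edge (f , g) leaves vertex (tl f , g)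
    LE : Set
    LE = Refinement (E L × Carrier) (λ p → Reach (tl L (proj₁ p)) (proj₂ p))

    Ltl : LE → LV
    Ltl ⟨ (f , g) , p ⟩ = ⟨ (tl L f , g) , p ⟩

    Lhd : LE → LV
    Lhd ⟨ (f , g) , p ⟩ = ⟨ (hd L f , g ∙ τ f) , Irr.map (stepF f) p ⟩

    endGrp' : E L → Carrier → Side → Carrier
    endGrp' f g tailS = g
    endGrp' f g headS = g ∙ τ f

    endGrp : LE × Side → Carrier
    endGrp (⟨ (f , g) , _ ⟩ , s) = endGrp' f g s

    endReach : ∀ f g s → Reach (tl L f) g → Reach (endV L (f , s)) (endGrp' f g s)
    endReach f g tailS p = p
    endReach f g headS p = stepF f p

    -- lift of the edge-end d' of L to the vertex (endV d' , g)
    liftEnd : (d' : End L) (g : Carrier) → Irrelevant (Reach (endV L d') g) → LE × Side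
    liftEnd (f , tailS) g p = ⟨ (f , g) , p ⟩ , tailS
    liftEnd (f , headS) g p = ⟨ (f , g ∙ τ f ⁻¹) , Irr.map (stepB f) p ⟩ , headS

    Lnxt : LE × Side → LE × Side
    Lnxt (⟨ (f , g) , p ⟩ , s) =
      liftEnd (nxt L (f , s)) (endGrp (⟨ (f , g) , p ⟩ , s))
        (Irr.map (λ q → subst (λ v → Reach v (endGrp' f g s)) (sym (nxt-at rotL (f , s))) (endReach f g s q)) p)

    Lprv : LE × Side → LE × Side
    Lprv (⟨ (f , g) , p ⟩ , s) =
      liftEnd (prv L (f , s)) (endGrp (⟨ (f , g) , p ⟩ , s))
        (Irr.map (λ q → subst (λ v → Reach v (endGrp' f g s)) (sym (prv-at L rotL (f , s))) (endReach f g s q)) p)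

    Lτ : Graph
    Lτ = record { V = LV ; E = LE ; tl = Ltl ; hd = Lhd ; nxt = Lnxt ; prv = Lprv }

    ℓ : Hom Lτ L
    ℓ = hom (λ v → proj₁ (value v)) (λ e → proj₁ (value e))

-- Duals.  D is a dual of H (with the rotation induced by the orientation,
-- rotations read counterclockwise, so face tracing keeps the face on the
-- right of the traversed edge).

-- the dual edge-end of e* corresponding to the edge-end (e , s) of H:
-- the tail end of e is on the right face = head of e*, and vice versa
dualEnd : (H D : Graph) → (E H → E D) → End H → End D
dualEnd H D star (e , s) = (star e , flipS s)

record IsDual (H D : Graph) : Set where
  field
    -- faces of H = orbits of face tracing; fc sends an edge-end d (a
    -- traversal of its edge leaving along d) to the face it traces
    fc       : End H → V D
    fc-step  : ∀ d → fc (fstep H d) ≡ fc d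
    fc-orbit : ∀ d d' → fc d ≡ fc d' → ∃ λ k → iter (fstep H) k d ≡ d'
    fc-surj  : ∀ f → ∃ λ d → fc d ≡ f
    star     : E H → E D
    unstar   : E D → E H
    unstar-star : ∀ e → unstar (star e) ≡ e
    star-unstar : ∀ e → star (unstar e) ≡ e
    -- e* goes from the face on the left of e to the face on the right
    tl-star  : ∀ e → tl D (star e) ≡ fc (e , headS)
    hd-star  : ∀ e → hd D (star e) ≡ fc (e , tailS)
    -- induced rotation at the dual vertex: the dual end corresponding
    -- to the edge-end d of H is dualEnd d; counterclockwise around a
    -- face is the inverse of the face-tracing order
    rot-star : ∀ d → nxt D (dualEnd H D star d) ≡ dualEnd H D star (fstep⁻¹ H d)

-- Face tracing in the dual H* runs backwards around the vertices of H, so with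
-- τ(e*) = ψ(e) the height of a facial walk of H* is the inverse of the rotation
-- product of ψ at the corresponding vertex of H: ψ is a flow iff τ is a local
-- tension.  In the derived graph H*_τ the second coordinate of a vertex is the
-- height of every walk reaching it from the base vertex, so τ ∘ ℓ is a global
-- tension.  Any other global covering r : K → H* factors through ℓ by sending v to
-- (r v, height of a walk from a fixed vertex over the base to v), well defined
-- because τ ∘ r is global.  Constructing walks in H*_τ requires a relevant witness
-- of reachability, obtained by a finite search: this is where finiteness of G and
-- of E(H) enters.
module Submission where

open import Defs
open import Algebra.Bundles using (Group)
import Algebra.Properties.Group as GroupProperties
open import Data.Bool using (Bool; true; false)
open import Data.Fin using (Fin; toℕ; combine)
open import Data.Fin.Properties using (pigeonhole; toℕ≤pred[n]; combine-injective)
open import Data.Irrelevant as Irrelevant using (Irrelevant; [_])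
open import Data.List as List using (List; []; _∷_; length; take; drop; replicate)
open import Data.List.Properties using (length-++; length-take; length-drop; take++drop≡id)
open import Data.Nat using (ℕ; zero; suc; _+_; _*_; _∸_; _⊓_; _≤_; _<_; _≤?_; z≤n; s≤s)
open import Data.Nat.Induction using (<-wellFounded)
open import Data.Nat.Properties
  using (≤-refl; ≤-trans; <⇒≤; ≰⇒>; n<1+n; +-mono-≤; +-monoˡ-<; m⊓n≤m; m+[n∸m]≡n)
open import Data.Product using (Σ; ∃; _×_; _,_; proj₁; proj₂)
open import Data.Refinement using (Refinement; value) renaming (_,_ to ⟨_,_⟩)
open import Function using (_∘_; _↣_; Injection; mk↔ₛ′)
open import Function.Properties.Inverse using (↔-sym; ↔-trans; ↔⇒↣)
open import Induction.WellFounded using (Acc; acc)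
open import Relation.Binary.Definitions using (DecidableEquality)
open import Relation.Binary.PropositionalEquality
open import Relation.Nullary using (Dec; yes; no)
open import Relation.Nullary.Decidable using (recompute; map′)

cut-loop-shorter : {A : Set} (xs : List A) {i j : ℕ} → i < j → j ≤ length xs →
                   length (take i xs List.++ drop j xs) < length xs
cut-loop-shorter xs {i} {j} i<j j≤n = begin-strict
  length (take i xs List.++ drop j xs)    ≡⟨ length-++ (take i xs) ⟩
  length (take i xs) + length (drop j xs) ≡⟨ cong₂ _+_ (length-take i xs) (length-drop j xs) ⟩
  i ⊓ length xs + (length xs ∸ j)         ≤⟨ +-mono-≤ (m⊓n≤m i (length xs)) ≤-refl ⟩
  i + (length xs ∸ j)                     <⟨ +-monoˡ-< (length xs ∸ j) i<j ⟩
  j + (length xs ∸ j)                     ≡⟨ m+[n∸m]≡n j≤n ⟩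
  length xs                               ∎
  where open Data.Nat.Properties.≤-Reasoning

finite-injection : {A : Set} (fin : Finite A) → A ↣ Fin (proj₁ fin)
finite-injection (n , iso) = ↔⇒↣ (↔-sym iso)

value-injective : {A : Set} {P : A → Set} {a b : Refinement A P} → value a ≡ value b → a ≡ b
value-injective {a = ⟨ _ , _ ⟩} {⟨ _ , _ ⟩} refl = refl

iter-suc : {A : Set} (f : A → A) (n : ℕ) (a : A) → iter f (suc n) a ≡ iter f n (f a)
iter-suc f zero    a = refl
iter-suc f (suc n) a = cong f (iter-suc f n a)

iter-cancel : {A : Set} {f g : A → A} → (∀ a → g (f a) ≡ a) →
              ∀ n a → iter g n (iter f n a) ≡ a
iter-cancel gf zero    a = refl
iter-cancel {f = f} {g} gf (suc n) a =
  trans (cong (λ b → g (iter g n b)) (iter-suc f n a))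
        (trans (cong g (iter-cancel gf n (f a))) (gf a))

iter-map : {A B : Set} {f : A → A} {g : B → B} (h : A → B) → (∀ a → g (h a) ≡ h (f a)) →
           ∀ n a → iter g n (h a) ≡ h (iter f n a)
iter-map h commute zero    a = refl
iter-map {g = g} h commute (suc n) a = trans (cong g (iter-map h commute n a)) (commute _)

iter-invariant : {A B : Set} {f : A → A} (h : A → B) → (∀ a → h (f a) ≡ h a) →
                 ∀ n a → h (iter f n a) ≡ h a
iter-invariant h invariant zero    a = refl
iter-invariant h invariant (suc n) a = trans (invariant _) (iter-invariant h invariant n a)

opp-involutive : (G : Graph) (d : End G) → opp G (opp G d) ≡ d
opp-involutive G (e , tailS) = refl
opp-involutive G (e , headS) = refl

module BoundedSearch {S : Set} {N : ℕ} (code : S → Fin N) (code-injective : ∀ {s t} → code s ≡ code t → s ≡ t)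
                     (move : Bool → S → S) where

  run : S → List Bool → S
  run s []       = s
  run s (b ∷ bs) = run (move b s) bs

  run-++ : ∀ s bs bs' → run s (bs List.++ bs') ≡ run (run s bs) bs'
  run-++ s []       bs' = refl
  run-++ s (b ∷ bs) bs' = run-++ (move b s) bs bs'

  Reachable : S → S → Set
  Reachable s t = Σ (List Bool) λ bs → run s bs ≡ t

  reachable-trans : ∀ {s t u} → Reachable s t → Reachable t u → Reachable s u
  reachable-trans {s} (bs , refl) (bs' , refl) = bs List.++ bs' , run-++ s bs bs'

  ReachableWithin : ℕ → S → S → Set
  ReachableWithin n s t = Σ (List Bool) λ bs → length bs ≤ n × run s bs ≡ t

  _≟_ : DecidableEquality S
  s ≟ t = map′ code-injective (cong code) (code s Data.Fin.≟ code t)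

  reachableWithin? : ∀ n s t → Dec (ReachableWithin n s t)
  reachableWithin? n s t with s ≟ t
  ... | yes s≡t = yes ([] , z≤n , s≡t)
  reachableWithin? zero s t | no s≢t = no λ { ([] , _ , s≡t) → s≢t s≡t ; (_ ∷ _ , () , _) }
  reachableWithin? (suc n) s t | no s≢t
    with reachableWithin? n (move false s) t | reachableWithin? n (move true s) t
  ... | yes (bs , short , reach) | _ = yes (false ∷ bs , s≤s short , reach)
  ... | no _ | yes (bs , short , reach) = yes (true ∷ bs , s≤s short , reach)
  ... | no ¬via-false | no ¬via-true = no λ where
    ([] , _ , s≡t)                  → s≢t s≡t
    (false ∷ bs , s≤s short , reach) → ¬via-false (bs , short , reach)
    (true ∷ bs , s≤s short , reach)  → ¬via-true (bs , short , reach)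

  -- By pigeonhole a run of more than N moves visits some state twice; drop the loop.
  cut-loop : ∀ s bs → N < length bs → Σ (List Bool) λ bs' → length bs' < length bs × run s bs' ≡ run s bs
  cut-loop s bs long with pigeonhole (n<1+n N) (λ k → code (run s (take (toℕ k) bs)))
  ... | i , j , i<j , same-code =
    take (toℕ i) bs List.++ drop (toℕ j) bs ,
    cut-loop-shorter bs i<j (≤-trans (toℕ≤pred[n] j) (<⇒≤ long)) ,
    (begin
      run s (take (toℕ i) bs List.++ drop (toℕ j) bs) ≡⟨ run-++ s (take (toℕ i) bs) (drop (toℕ j) bs) ⟩
      run (run s (take (toℕ i) bs)) (drop (toℕ j) bs) ≡⟨ cong (λ s' → run s' (drop (toℕ j) bs)) (code-injective same-code) ⟩
      run (run s (take (toℕ j) bs)) (drop (toℕ j) bs) ≡⟨ run-++ s (take (toℕ j) bs) (drop (toℕ j) bs) ⟨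
      run s (take (toℕ j) bs List.++ drop (toℕ j) bs) ≡⟨ cong (run s) (take++drop≡id (toℕ j) bs) ⟩
      run s bs                                        ∎)
    where open ≡-Reasoning

  shorten : ∀ s bs → Acc _<_ (length bs) → ReachableWithin N s (run s bs)
  shorten s bs (acc shorter-acc) with length bs ≤? N
  ... | yes short = bs , short , refl
  ... | no long with cut-loop s bs (≰⇒> long)
  ... | bs' , shorter , same with shorten s bs' (shorter-acc shorter)
  ... | bs″ , short , reach = bs″ , short , trans reach same

  reachable-recompute : ∀ s t → .(Reachable s t) → Reachable s t
  reachable-recompute s t reach with recompute (reachableWithin? N s t) (within reach)
    where
    within : Reachable s t → ReachableWithin N s t
    within (bs , refl) = shorten s bs (<-wellFounded (length bs))
  ... | bs , _ , reach′ = bs , reach′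

module Walks (G : Graph) where

  infixr 5 _++_

  _++_ : ∀ {u v w} → Walk G u v → Walk G v w → Walk G u w
  []      ++ W' = W'
  fwd e W ++ W' = fwd e (W ++ W')
  bwd e W ++ W' = bwd e (W ++ W')

  reverse : ∀ {u v} → Walk G u v → Walk G v u
  reverse []        = []
  reverse (fwd e W) = reverse W ++ bwd e []
  reverse (bwd e W) = reverse W ++ fwd e []

module _ {H D : Graph} (dual : IsDual H D) where
  open IsDual dual
  open Walks D

  dual-edges-finite : Finite (E H) → Finite (E D)
  dual-edges-finite (n , iso) = n , ↔-trans iso (mk↔ₛ′ star unstar star-unstar unstar-star)

  dual-end-at : ∀ v → ∃ λ d → endV D d ≡ v
  dual-end-at v with fc-surj v
  ... | (e , tailS) , refl = (star e , headS) , hd-star e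
  ... | (e , headS) , refl = (star e , tailS) , tl-star e

  face-opp-walk : ∀ d → Walk D (fc d) (fc (opp H d))
  face-opp-walk (e , tailS) = subst₂ (Walk D) (hd-star e) (tl-star e) (bwd (star e) [])
  face-opp-walk (e , headS) = subst₂ (Walk D) (tl-star e) (hd-star e) (fwd (star e) [])

  face-nxt-walk : ∀ d → Walk D (fc d) (fc (nxt H d))
  face-nxt-walk d = subst (λ d' → Walk D (fc d) (fc (nxt H d')))
                          (opp-involutive H d) (face-opp-walk d ++ face-step-walk)
    where
    face-step-walk : Walk D (fc (opp H d)) (fc (fstep H (opp H d)))
    face-step-walk = subst (Walk D (fc (opp H d))) (sym (fc-step (opp H d))) []

  face-rotate-walk : ∀ k d → Walk D (fc d) (fc (iter (nxt H) k d))
  face-rotate-walk zero    d = []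
  face-rotate-walk (suc k) d = face-rotate-walk k d ++ face-nxt-walk (iter (nxt H) k d)

  module _ (rotH : IsRot H) where

    face-around-walk : ∀ d d' → endV H d ≡ endV H d' → Walk D (fc d) (fc d')
    face-around-walk d d' same with cyclic rotH d d' same
    ... | k , nxtᵏd≡d' = subst (λ d″ → Walk D (fc d) (fc d″)) nxtᵏd≡d' (face-rotate-walk k d)

    face-walk : ∀ {u v} → Walk H u v → ∀ d d' → endV H d ≡ u → endV H d' ≡ v →
                Walk D (fc d) (fc d')
    face-walk []        d d' at-u at-v = face-around-walk d d' (trans at-u (sym at-v))
    face-walk (fwd e W) d d' at-u at-v =
      face-around-walk d (e , tailS) at-u ++ face-opp-walk (e , tailS) ++ face-walk W (e , headS) d' refl at-v
    face-walk (bwd e W) d d' at-u at-v =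
      face-around-walk d (e , headS) at-u ++ face-opp-walk (e , headS) ++ face-walk W (e , tailS) d' refl at-v

    dual-connected : Connected H → Connected D
    dual-connected connH a b with fc-surj a | fc-surj b
    ... | d , refl | d' , refl = face-walk (connH (endV H d) (endV H d')) d d' refl refl

module _ (𝔾 : Grp) where
  open Grp 𝔾

  group : Group _ _
  group = record { Carrier = Carrier ; _≈_ = _≡_ ; _∙_ = _∙_ ; ε = ε ; _⁻¹ = _⁻¹ ; isGroup = isGroup }

  open Group group using (assoc; identityˡ; identityʳ)
  open GroupProperties group
    using (⁻¹-involutive; ⁻¹-anti-homo-∙; ⁻¹-injective; ε⁻¹≈ε; x∙y⁻¹≈ε⇒x≈y; identityʳ-unique;
           ∙-cancelʳ; //-rightDividesˡ; //-rightDividesʳ)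

  module Heights (G : Graph) (φ : E G → Carrier) where
    open Walks G
    open ≡-Reasoning

    ∣_∣ : ∀ {u v} → Walk G u v → Carrier
    ∣ W ∣ = height 𝔾 G φ W

    height-++ : ∀ {u v w} (W : Walk G u v) (W' : Walk G v w) → ∣ W ++ W' ∣ ≡ ∣ W ∣ ∙ ∣ W' ∣
    height-++ []        W' = sym (identityˡ _)
    height-++ (fwd e W) W' = trans (cong (φ e ∙_) (height-++ W W')) (sym (assoc _ _ _))
    height-++ (bwd e W) W' = trans (cong (φ e ⁻¹ ∙_) (height-++ W W')) (sym (assoc _ _ _))

    height-reverse : ∀ {u v} (W : Walk G u v) → ∣ reverse W ∣ ≡ ∣ W ∣ ⁻¹
    height-reverse []        = sym ε⁻¹≈ε
    height-reverse (fwd e W) = begin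
      ∣ reverse W ++ bwd e [] ∣ ≡⟨ height-++ (reverse W) (bwd e []) ⟩
      ∣ reverse W ∣ ∙ (φ e ⁻¹ ∙ ε) ≡⟨ cong₂ _∙_ (height-reverse W) (identityʳ _) ⟩
      ∣ W ∣ ⁻¹ ∙ φ e ⁻¹           ≡⟨ ⁻¹-anti-homo-∙ (φ e) ∣ W ∣ ⟨
      (φ e ∙ ∣ W ∣) ⁻¹            ∎
    height-reverse (bwd e W) = begin
      ∣ reverse W ++ fwd e [] ∣ ≡⟨ height-++ (reverse W) (fwd e []) ⟩
      ∣ reverse W ∣ ∙ (φ e ∙ ε)   ≡⟨ cong₂ _∙_ (height-reverse W) (trans (identityʳ _) (sym (⁻¹-involutive _))) ⟩
      ∣ W ∣ ⁻¹ ∙ φ e ⁻¹ ⁻¹        ≡⟨ ⁻¹-anti-homo-∙ (φ e ⁻¹) ∣ W ∣ ⟨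
      (φ e ⁻¹ ∙ ∣ W ∣) ⁻¹         ∎

    height-path-independent : GlobalTension 𝔾 G φ → ∀ {u v} (W W' : Walk G u v) → ∣ W ∣ ≡ ∣ W' ∣
    height-path-independent global {u} W W' = x∙y⁻¹≈ε⇒x≈y ∣ W ∣ ∣ W' ∣ (begin
      ∣ W ∣ ∙ ∣ W' ∣ ⁻¹          ≡⟨ cong (∣ W ∣ ∙_) (height-reverse W') ⟨
      ∣ W ∣ ∙ ∣ reverse W' ∣      ≡⟨ height-++ W (reverse W') ⟨
      ∣ W ++ reverse W' ∣         ≡⟨ global u (W ++ reverse W') ⟩
      ε                           ∎)

  orbitProd : {A : Set} → (A → A) → (A → Carrier) → A → ℕ → Carrier
  orbitProd p f a zero    = ε
  orbitProd p f a (suc n) = f a ∙ orbitProd p f (p a) n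

  faceHeight≡orbitProd : ∀ G φ d n → faceHeight 𝔾 G φ d n ≡ orbitProd (fstep G) (dartVal 𝔾 G φ) d n
  faceHeight≡orbitProd G φ d zero    = refl
  faceHeight≡orbitProd G φ d (suc n) = cong (dartVal 𝔾 G φ d ∙_) (faceHeight≡orbitProd G φ (fstep G d) n)

  rotProd≡orbitProd : ∀ G ψ d n → rotProd 𝔾 G ψ d n ≡ orbitProd (nxt G) (flowVal 𝔾 G ψ) d n
  rotProd≡orbitProd G ψ d zero    = refl
  rotProd≡orbitProd G ψ d (suc n) = cong (flowVal 𝔾 G ψ d ∙_) (rotProd≡orbitProd G ψ (nxt G d) n)

  orbitProd-map : {A B : Set} {p : A → A} {f : A → Carrier} {p' : B → B} {f' : B → Carrier}
                  (h : A → B) → (∀ a → p' (h a) ≡ h (p a)) → (∀ a → f' (h a) ≡ f a) →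
                  ∀ n a → orbitProd p' f' (h a) n ≡ orbitProd p f a n
  orbitProd-map h p-commute f-commute zero    a = refl
  orbitProd-map {p = p} {p' = p'} {f'} h p-commute f-commute (suc n) a =
    cong₂ _∙_ (f-commute a)
      (trans (cong (λ b → orbitProd p' f' b n) (p-commute a)) (orbitProd-map h p-commute f-commute n (p a)))

  orbitProd-snoc : {A : Set} (p : A → A) (f : A → Carrier) →
                   ∀ n a → orbitProd p f a (suc n) ≡ orbitProd p f a n ∙ f (iter p n a)
  orbitProd-snoc p f zero    a = trans (identityʳ _) (sym (identityˡ _))
  orbitProd-snoc p f (suc n) a = begin
    f a ∙ orbitProd p f (p a) (suc n)                ≡⟨ cong (f a ∙_) (orbitProd-snoc p f n (p a)) ⟩
    f a ∙ (orbitProd p f (p a) n ∙ f (iter p n (p a))) ≡⟨ assoc _ _ _ ⟨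
    f a ∙ orbitProd p f (p a) n ∙ f (iter p n (p a))   ≡⟨ cong (λ b → f a ∙ orbitProd p f (p a) n ∙ f b) (iter-suc p n a) ⟨
    f a ∙ orbitProd p f (p a) n ∙ f (iter p (suc n) a) ∎
    where open ≡-Reasoning

  orbitProd-reverse : {A : Set} {p q : A → A} → (∀ a → q (p a) ≡ a) → (f : A → Carrier) →
                      ∀ n a → orbitProd p (λ b → f b ⁻¹) a (suc n) ≡ orbitProd q f (iter p n a) (suc n) ⁻¹
  orbitProd-reverse qp f zero    a = trans (identityʳ _) (cong _⁻¹ (sym (identityʳ _)))
  orbitProd-reverse {A} {p} {q} qp f (suc n) a = begin
    f a ⁻¹ ∙ orbitProd p (λ c → f c ⁻¹) (p a) (suc n)    ≡⟨ cong (f a ⁻¹ ∙_) (orbitProd-reverse qp f n (p a)) ⟩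
    f a ⁻¹ ∙ orbitProd q f (iter p n (p a)) (suc n) ⁻¹   ≡⟨ cong (λ c → f a ⁻¹ ∙ orbitProd q f c (suc n) ⁻¹) (iter-suc p n a) ⟨
    f a ⁻¹ ∙ orbitProd q f b (suc n) ⁻¹                  ≡⟨ ⁻¹-anti-homo-∙ (orbitProd q f b (suc n)) (f a) ⟨
    (orbitProd q f b (suc n) ∙ f a) ⁻¹                   ≡⟨ cong (λ c → (orbitProd q f b (suc n) ∙ f c) ⁻¹) (iter-cancel {f = p} {q} qp (suc n) a) ⟨
    (orbitProd q f b (suc n) ∙ f (iter q (suc n) b)) ⁻¹  ≡⟨ cong _⁻¹ (orbitProd-snoc q f (suc n) b) ⟨
    orbitProd q f b (suc (suc n)) ⁻¹                     ∎
    where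
    open ≡-Reasoning
    b : A
    b = iter p (suc n) a

  module FlowDuality {H D : Graph} (rotH : IsRot H) (dual : IsDual H D)
                     (τ : E D → Carrier) (ψ : E H → Carrier) (τ∘star : ∀ e → τ (IsDual.star dual e) ≡ ψ e) where
    open IsDual dual
    open ≡-Reasoning

    -- The end of e* on the same side as d on e; face tracing in D then runs
    -- backwards around the vertices of H.
    ι : End H → End D
    ι (e , s) = (star e , s)

    ι-injective : ∀ {a b} → ι a ≡ ι b → a ≡ b
    ι-injective {e , s} {e' , s'} eq =
      cong₂ _,_ (trans (sym (unstar-star e)) (trans (cong (unstar ∘ proj₁) eq) (unstar-star e')))
                (cong proj₂ eq)

    ι-surjective : ∀ d → ι (unstar (proj₁ d) , proj₂ d) ≡ d
    ι-surjective (e , s) = cong (_, s) (star-unstar e)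

    fstep-ι : ∀ d → fstep D (ι d) ≡ ι (prv H d)
    fstep-ι d = trans (rot-star d) (dualEnd-opp (prv H d))
      where
      dualEnd-opp : ∀ d → dualEnd H D star (opp H d) ≡ ι d
      dualEnd-opp (e , tailS) = refl
      dualEnd-opp (e , headS) = refl

    iter-fstep-ι : ∀ n a → iter (fstep D) n (ι a) ≡ ι (iter (prv H) n a)
    iter-fstep-ι = iter-map ι fstep-ι

    dartVal-ι : ∀ d → dartVal 𝔾 D τ (ι d) ≡ flowVal 𝔾 H ψ d ⁻¹
    dartVal-ι (e , tailS) = trans (τ∘star e) (sym (⁻¹-involutive _))
    dartVal-ι (e , headS) = cong _⁻¹ (τ∘star e)

    faceHeight-ι : ∀ n a → faceHeight 𝔾 D τ (ι a) (suc n) ≡ rotProd 𝔾 H ψ (iter (prv H) n a) (suc n) ⁻¹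
    faceHeight-ι n a = begin
      faceHeight 𝔾 D τ (ι a) (suc n)                              ≡⟨ faceHeight≡orbitProd D τ (ι a) (suc n) ⟩
      orbitProd (fstep D) (dartVal 𝔾 D τ) (ι a) (suc n)           ≡⟨ orbitProd-map ι fstep-ι dartVal-ι (suc n) a ⟩
      orbitProd (prv H) (λ d → flowVal 𝔾 H ψ d ⁻¹) a (suc n)     ≡⟨ orbitProd-reverse (nxt-prv rotH) (flowVal 𝔾 H ψ) n a ⟩
      orbitProd (nxt H) (flowVal 𝔾 H ψ) (iter (prv H) n a) (suc n) ⁻¹
                                          ≡⟨ cong _⁻¹ (rotProd≡orbitProd H ψ (iter (prv H) n a) (suc n)) ⟨
      rotProd 𝔾 H ψ (iter (prv H) n a) (suc n) ⁻¹                 ∎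

    flow⇒dual-local : IsFlow 𝔾 H ψ → LocalTension 𝔾 D τ
    flow⇒dual-local flow d k closed =
      subst (λ d → iter (fstep D) (suc k) d ≡ d → faceHeight 𝔾 D τ d (suc k) ≡ ε)
            (ι-surjective d) (local-at-ι _) closed
      where
      local-at-ι : ∀ a → iter (fstep D) (suc k) (ι a) ≡ ι a → faceHeight 𝔾 D τ (ι a) (suc k) ≡ ε
      local-at-ι a closed-ι = begin
        faceHeight 𝔾 D τ (ι a) (suc k)  ≡⟨ faceHeight-ι k a ⟩
        rotProd 𝔾 H ψ b (suc k) ⁻¹      ≡⟨ cong _⁻¹ (flow b k closed-at-b) ⟩
        ε ⁻¹                            ≡⟨ ε⁻¹≈ε ⟩
        ε                               ∎
        where
        b : End H
        b = iter (prv H) k a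
        prv-closed : prv H b ≡ a
        prv-closed = ι-injective (trans (sym (iter-fstep-ι (suc k) a)) closed-ι)
        closed-at-b : iter (nxt H) (suc k) b ≡ b
        closed-at-b = trans (cong (nxt H) (iter-cancel (nxt-prv rotH) k a))
                            (trans (cong (nxt H) (sym prv-closed)) (nxt-prv rotH b))

    dual-local⇒flow : LocalTension 𝔾 D τ → IsFlow 𝔾 H ψ
    dual-local⇒flow local d k closed = ⁻¹-injective (begin
      rotProd 𝔾 H ψ d (suc k) ⁻¹                   ≡⟨ cong (λ c → rotProd 𝔾 H ψ c (suc k) ⁻¹) prv-back ⟨
      rotProd 𝔾 H ψ (iter (prv H) k a) (suc k) ⁻¹  ≡⟨ faceHeight-ι k a ⟨
      faceHeight 𝔾 D τ (ι a) (suc k)               ≡⟨ local (ι a) k closed-ι ⟩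
      ε                                             ≡⟨ ε⁻¹≈ε ⟨
      ε ⁻¹                                          ∎)
      where
      a : End H
      a = iter (nxt H) k d
      prv-back : iter (prv H) k a ≡ d
      prv-back = iter-cancel (prv-nxt rotH) k d
      prv-closed : iter (prv H) (suc k) a ≡ a
      prv-closed = trans (cong (prv H) prv-back)
                         (trans (cong (prv H) (sym closed)) (prv-nxt rotH a))
      closed-ι : iter (fstep D) (suc k) (ι a) ≡ ι a
      closed-ι = trans (iter-fstep-ι (suc k) a) (cong ι prv-closed)

  -- Vertices of L_τ carry their Reach proof irrelevantly.  A relevant one is
  -- recovered by deciding reachability: search the finitely many states
  -- (edge-end, group element), moving by rotation or by crossing an edge.
  module FiniteReach (finG : Finite Carrier) {L : Graph} (rotL : IsRot L) (finE : Finite (E L))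
                     (end-at : ∀ v → ∃ λ d → endV L d ≡ v) (τ : E L → Carrier) (x : V L) where
    open Derived 𝔾 L rotL τ x using (Reach; base; stepF; stepB)

    State : Set
    State = End L × Carrier

    move : Bool → State → State
    move false (d , g) = (nxt L d , g)
    move true  (d , g) = (opp L d , g ∙ dartVal 𝔾 L τ d)

    side-code : Side → Fin 2
    side-code tailS = Data.Fin.zero
    side-code headS = Data.Fin.suc Data.Fin.zero

    side-code-injective : ∀ {s s'} → side-code s ≡ side-code s' → s ≡ s'
    side-code-injective {tailS} {tailS} eq = refl
    side-code-injective {headS} {headS} eq = refl

    module Codeᴱ = Injection (finite-injection finE)
    module Codeᴳ = Injection (finite-injection finG)

    code : State → Fin (proj₁ finE * (2 * proj₁ finG))
    code ((e , s) , g) = combine (Codeᴱ.to e) (combine (side-code s) (Codeᴳ.to g))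

    code-injective : ∀ {σ σ'} → code σ ≡ code σ' → σ ≡ σ'
    code-injective {(e , s) , g} {(e' , s') , g'} eq
      with combine-injective _ _ _ _ eq
    ... | e≡e' , rest with combine-injective _ _ _ _ rest
    ... | s≡s' , g≡g' =
      cong₂ _,_ (cong₂ _,_ (Codeᴱ.injective e≡e') (side-code-injective s≡s')) (Codeᴳ.injective g≡g')

    open BoundedSearch code code-injective move

    ReachState : State → Set
    ReachState (d , g) = Reach (endV L d) g

    move-ReachState : ∀ b σ → ReachState σ → ReachState (move b σ)
    move-ReachState false (d , g)          r = subst (λ v → Reach v g) (sym (nxt-at rotL d)) r
    move-ReachState true  ((f , tailS) , g) r = stepF f r
    move-ReachState true  ((f , headS) , g) r = stepB f r

    run-ReachState : ∀ bs σ → ReachState σ → ReachState (run σ bs)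
    run-ReachState []       σ r = r
    run-ReachState (b ∷ bs) σ r = run-ReachState bs (move b σ) (move-ReachState b σ r)

    run-rotate : ∀ k d g → run (d , g) (replicate k false) ≡ (iter (nxt L) k d , g)
    run-rotate zero    d g = refl
    run-rotate (suc k) d g = trans (run-rotate k (nxt L d) g) (cong (_, g) (sym (iter-suc (nxt L) k d)))

    rotate : ∀ d d' g → endV L d ≡ endV L d' → Reachable (d , g) (d' , g)
    rotate d d' g same with cyclic rotL d d' same
    ... | k , nxtᵏd≡d' = replicate k false , trans (run-rotate k d g) (cong (_, g) nxtᵏd≡d')

    start : State
    start = (proj₁ (end-at x) , ε)

    Reach⇒reachable : ∀ {a g} → Reach a g → ∀ d → endV L d ≡ a → Reachable start (d , g)
    Reach⇒reachable base          d at = rotate _ d ε (trans (proj₂ (end-at x)) (sym at))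
    Reach⇒reachable (stepF f r) d at =
      reachable-trans (Reach⇒reachable r (f , tailS) refl)
        (reachable-trans (true ∷ [] , refl) (rotate (f , headS) d _ (sym at)))
    Reach⇒reachable (stepB f r) d at =
      reachable-trans (Reach⇒reachable r (f , headS) refl)
        (reachable-trans (true ∷ [] , refl) (rotate (f , tailS) d _ (sym at)))

    start-ReachState : ReachState start
    start-ReachState = subst (λ v → Reach v ε) (sym (proj₂ (end-at x))) base

    Reach-recompute : ∀ {a g} → Irrelevant (Reach a g) → Reach a g
    Reach-recompute {a} {g} [ r ] =
      subst (λ v → Reach v g) at (subst ReachState (proj₂ path) (run-ReachState (proj₁ path) start start-ReachState))
      where
      d : End L
      d = proj₁ (end-at a)
      at : endV L d ≡ a
      at = proj₂ (end-at a)
      path : Reachable start (d , g)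
      path = reachable-recompute start (d , g) (Reach⇒reachable r d at)

  module DerivedGraph {L : Graph} (rotL : IsRot L) (τ : E L → Carrier) (x : V L) where
    open Derived 𝔾 L rotL τ x

    level : LV → Carrier
    level u = proj₂ (value u)

    endV-value : ∀ d → value (endV Lτ d) ≡ (endV L (endMap ℓ d) , endGrp d)
    endV-value (⟨ _ , _ ⟩ , tailS) = refl
    endV-value (⟨ _ , _ ⟩ , headS) = refl

    endV-value-≡ : ∀ {d u} → endV Lτ d ≡ u → (endV L (endMap ℓ d) , endGrp d) ≡ value u
    endV-value-≡ {d} at = trans (sym (endV-value d)) (cong value at)

    endV-value-cong : ∀ d d' → endV Lτ d ≡ endV Lτ d' →
                      (endV L (endMap ℓ d) , endGrp d) ≡ (endV L (endMap ℓ d') , endGrp d')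
    endV-value-cong d d' same = trans (endV-value-≡ {d} same) (endV-value d')

    end-ext : ∀ {d d'} → endMap ℓ d ≡ endMap ℓ d' → endGrp d ≡ endGrp d' → d ≡ d'
    end-ext {⟨ (f , g) , _ ⟩ , tailS} {⟨ (.f , .g) , _ ⟩ , .tailS} refl refl = refl
    end-ext {⟨ (f , g) , _ ⟩ , headS} {⟨ (.f , g') , _ ⟩ , .headS} refl same
      with ∙-cancelʳ (τ f) g g' same
    ... | refl = refl

    endMap-liftEnd : ∀ d' g p → endMap ℓ (liftEnd d' g p) ≡ d'
    endMap-liftEnd (f , tailS) g p = refl
    endMap-liftEnd (f , headS) g p = refl

    endGrp-liftEnd : ∀ d' g p → endGrp (liftEnd d' g p) ≡ g
    endGrp-liftEnd (f , tailS) g p = refl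
    endGrp-liftEnd (f , headS) g p = //-rightDividesˡ (τ f) g

    endMap-Lnxt : ∀ d → endMap ℓ (Lnxt d) ≡ nxt L (endMap ℓ d)
    endMap-Lnxt (⟨ (f , g) , _ ⟩ , s) = endMap-liftEnd (nxt L (f , s)) (endGrp' f g s) _

    endGrp-Lnxt : ∀ d → endGrp (Lnxt d) ≡ endGrp d
    endGrp-Lnxt (⟨ (f , g) , _ ⟩ , s) = endGrp-liftEnd (nxt L (f , s)) (endGrp' f g s) _

    endMap-Lprv : ∀ d → endMap ℓ (Lprv d) ≡ prv L (endMap ℓ d)
    endMap-Lprv (⟨ (f , g) , _ ⟩ , s) = endMap-liftEnd (prv L (f , s)) (endGrp' f g s) _

    endGrp-Lprv : ∀ d → endGrp (Lprv d) ≡ endGrp d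
    endGrp-Lprv (⟨ (f , g) , _ ⟩ , s) = endGrp-liftEnd (prv L (f , s)) (endGrp' f g s) _

    Lτ-rotation : IsRot Lτ
    Lτ-rotation = record
      { nxt-prv = λ d → end-ext
          (trans (endMap-Lnxt (Lprv d)) (trans (cong (nxt L) (endMap-Lprv d)) (nxt-prv rotL _)))
          (trans (endGrp-Lnxt (Lprv d)) (endGrp-Lprv d))
      ; prv-nxt = λ d → end-ext
          (trans (endMap-Lprv (Lnxt d)) (trans (cong (prv L) (endMap-Lnxt d)) (prv-nxt rotL _)))
          (trans (endGrp-Lprv (Lnxt d)) (endGrp-Lnxt d))
      ; nxt-at = λ d → value-injective (trans (endV-value (Lnxt d))
          (trans (cong₂ _,_ (trans (cong (endV L) (endMap-Lnxt d)) (nxt-at rotL _)) (endGrp-Lnxt d))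
                 (sym (endV-value d))))
      ; cyclic = cyclic-Lτ
      }
      where
      cyclic-Lτ : ∀ d d' → endV Lτ d ≡ endV Lτ d' → ∃ λ k → iter Lnxt k d ≡ d'
      cyclic-Lτ d d' same with cyclic rotL (endMap ℓ d) (endMap ℓ d') (cong proj₁ (endV-value-cong d d' same))
      ... | k , nxtᵏ≡ = k , end-ext
            (trans (sym (iter-map (endMap ℓ) (λ a → sym (endMap-Lnxt a)) k d)) nxtᵏ≡)
            (trans (iter-invariant endGrp endGrp-Lnxt k d) (cong proj₂ (endV-value-cong d d' same)))

    level-along : ∀ {u v} (W : Walk Lτ u v) → level u ∙ height 𝔾 Lτ (τ ∘ em ℓ) W ≡ level v
    level-along []                       = identityʳ _
    level-along (fwd ⟨ (f , g) , _ ⟩ W) = trans (sym (assoc _ _ _)) (level-along W)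
    level-along (bwd ⟨ (f , g) , _ ⟩ W) =
      trans (sym (assoc _ _ _)) (trans (cong (_∙ height 𝔾 Lτ (τ ∘ em ℓ) W) (//-rightDividesʳ (τ f) g)) (level-along W))

    ℓ-global : GlobalTension 𝔾 Lτ (τ ∘ em ℓ)
    ℓ-global v W = identityʳ-unique (level v) _ (level-along W)

    reach-along : {K : Graph} (r : Hom K L) →
                  (∀ e → tl L (em r e) ≡ vm r (tl K e)) → (∀ e → hd L (em r e) ≡ vm r (hd K e)) →
                  ∀ {a b g} (W : Walk K a b) → Reach (vm r a) g → Reach (vm r b) (g ∙ height 𝔾 K (τ ∘ em r) W)
    reach-along r tl-r hd-r {g = g} []        reach = subst (Reach _) (sym (identityʳ g)) reach
    reach-along r tl-r hd-r {g = g} (fwd e W) reach =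
      subst (Reach _) (assoc _ _ _) (reach-along r tl-r hd-r W
        (subst (λ v → Reach v _) (hd-r e) (stepF (em r e) (subst (λ v → Reach v g) (sym (tl-r e)) reach))))
    reach-along r tl-r hd-r {g = g} (bwd e W) reach =
      subst (Reach _) (assoc _ _ _) (reach-along r tl-r hd-r W
        (subst (λ v → Reach v _) (tl-r e) (stepB (em r e) (subst (λ v → Reach v g) (sym (hd-r e)) reach))))

    module _ (connL : Connected L) where

      reach-from-base : ∀ v → Reach v (ε ∙ height 𝔾 L τ (connL x v))
      reach-from-base v = reach-along (hom (λ u → u) (λ e → e)) (λ _ → refl) (λ _ → refl) (connL x v) base

      ℓ-covering : IsCovering Lτ L ℓ
      ℓ-covering = record
        { tl-pres   = λ { ⟨ _ , _ ⟩ → refl }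
        ; hd-pres   = λ { ⟨ _ , _ ⟩ → refl }
        ; surjV     = λ v → ⟨ (v , _) , [ reach-from-base v ] ⟩ , refl
        ; surjE     = λ f → ⟨ (f , _) , [ reach-from-base (tl L f) ] ⟩ , refl
        ; ends-inj  = λ d d' same-vertex same-end →
            end-ext same-end (cong proj₂ (endV-value-cong d d' same-vertex))
        ; ends-surj = ends-surj-ℓ
        ; rot-pres  = endMap-Lnxt
        }
        where
        ends-surj-ℓ : ∀ u d' → endV L d' ≡ vm ℓ u → ∃ λ d → (endV Lτ d ≡ u) × (endMap ℓ d ≡ d')
        ends-surj-ℓ ⟨ (_ , g) , p ⟩ d' at =
          liftEnd d' g p' ,
          value-injective (trans (endV-value (liftEnd d' g p'))
                            (cong₂ _,_ (trans (cong (endV L) (endMap-liftEnd d' g p')) at) (endGrp-liftEnd d' g p'))) ,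
          endMap-liftEnd d' g p'
          where
          p' : Irrelevant (Reach (endV L d') g)
          p' = Irrelevant.map (subst (λ v → Reach v g) (sym at)) p

      module _ (Reach-recompute : ∀ {a g} → Irrelevant (Reach a g) → Reach a g) where
        open Walks Lτ

        base-vertex : LV
        base-vertex = ⟨ (x , ε) , [ base ] ⟩

        walk-from-base : ∀ {a g} (r : Reach a g) → Walk Lτ base-vertex ⟨ (a , g) , [ r ] ⟩
        walk-from-base base             = []
        walk-from-base (stepF {g} f r) = walk-from-base r ++ fwd ⟨ (f , g) , [ r ] ⟩ []
        walk-from-base (stepB {g} f r) =
          subst (Walk Lτ base-vertex) (value-injective (cong (hd L f ,_) (sym (//-rightDividesˡ (τ f) g)))) (walk-from-base r)
          ++ bwd ⟨ (f , g ∙ τ f ⁻¹) , [ stepB f r ] ⟩ []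

        Lτ-connected : Connected Lτ
        Lτ-connected ⟨ _ , p ⟩ ⟨ _ , p' ⟩ =
          reverse (walk-from-base (Reach-recompute p)) ++ walk-from-base (Reach-recompute p')

        -- A global covering K → L is lifted to L_τ by recording, at each vertex,
        -- the height of any walk from a fixed vertex u₀ above x.
        module Lift {K : Graph} {r : Hom K L} (global-r : GlobalCovering 𝔾 L τ K r) where
          open GlobalCovering global-r renaming (rotK to rot-K; connK to conn-K)
          open Heights K (τ ∘ em r) using (∣_∣; height-++; height-path-independent)
          module WK = Walks K

          u₀ : V K
          u₀ = proj₁ (surjV cov x)

          potential : V K → Carrier
          potential v = ∣ conn-K u₀ v ∣

          potential-hd : ∀ e → potential (hd K e) ≡ potential (tl K e) ∙ τ (em r e)
          potential-hd e =
            trans (height-path-independent global (conn-K u₀ (hd K e)) (conn-K u₀ (tl K e) WK.++ fwd e []))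
                  (trans (height-++ (conn-K u₀ (tl K e)) (fwd e [])) (cong (potential (tl K e) ∙_) (identityʳ _)))

          Reach-potential : ∀ v → Reach (vm r v) (potential v)
          Reach-potential v = subst (Reach _) (identityˡ _)
            (reach-along r (tl-pres cov) (hd-pres cov) (conn-K u₀ v)
              (subst (λ a → Reach a ε) (sym (proj₂ (surjV cov x))) base))

          lift-Reach : ∀ {a g} → Reach a g → ∃ λ v → (vm r v ≡ a) × (potential v ≡ g)
          lift-Reach base = u₀ , proj₂ (surjV cov x) , height-path-independent global (conn-K u₀ u₀) []
          lift-Reach (stepF f reach) with lift-Reach reach
          ... | v , over , level-v with ends-surj cov v (f , tailS) (sym over)
          ... | (e , tailS) , refl , refl = hd K e , sym (hd-pres cov e) , trans (potential-hd e) (cong (_∙ τ (em r e)) level-v)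
          lift-Reach (stepB f reach) with lift-Reach reach
          ... | v , over , level-v with ends-surj cov v (f , headS) (sym over)
          ... | (e , headS) , refl , refl = tl K e , sym (tl-pres cov e) ,
                  trans (sym (//-rightDividesʳ (τ (em r e)) (potential (tl K e))))
                        (cong (_∙ τ (em r e) ⁻¹) (trans (sym (potential-hd e)) level-v))

          q : Hom K Lτ
          q = hom (λ v → ⟨ (vm r v , potential v) , [ Reach-potential v ] ⟩)
                  (λ e → ⟨ (em r e , potential (tl K e)) ,
                           [ subst (λ a → Reach a (potential (tl K e))) (sym (tl-pres cov e)) (Reach-potential (tl K e)) ] ⟩)

          endMap-q : ∀ d → endMap ℓ (endMap q d) ≡ endMap r d
          endMap-q (e , s) = refl

          endGrp-q : ∀ d → endGrp (endMap q d) ≡ potential (endV K d)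
          endGrp-q (e , tailS) = refl
          endGrp-q (e , headS) = sym (potential-hd e)

          q-covering : IsCovering K Lτ q
          q-covering = record
            { tl-pres   = λ e → value-injective (cong (_, potential (tl K e)) (tl-pres cov e))
            ; hd-pres   = λ e → value-injective (cong₂ _,_ (hd-pres cov e) (sym (potential-hd e)))
            ; surjV     = surjV-q
            ; surjE     = surjE-q
            ; ends-inj  = λ d d' same-vertex same-end →
                ends-inj cov d d' same-vertex (trans (sym (endMap-q d)) (trans (cong (endMap ℓ) same-end) (endMap-q d')))
            ; ends-surj = ends-surj-q
            ; rot-pres  = λ d → end-ext
                (trans (endMap-q (nxt K d)) (trans (rot-pres cov d)
                  (trans (cong (nxt L) (sym (endMap-q d))) (sym (endMap-Lnxt (endMap q d))))))
                (trans (endGrp-q (nxt K d)) (trans (cong potential (nxt-at rot-K d))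
                  (trans (sym (endGrp-q d)) (sym (endGrp-Lnxt (endMap q d))))))
            }
            where
            surjV-q : ∀ u → ∃ λ v → vm q v ≡ u
            surjV-q ⟨ _ , p ⟩ with lift-Reach (Reach-recompute p)
            ... | v , over , level-v = v , value-injective (cong₂ _,_ over level-v)

            surjE-q : ∀ f → ∃ λ e → em q e ≡ f
            surjE-q ⟨ (f , g) , p ⟩ with lift-Reach (Reach-recompute p)
            ... | v , over , level-v with ends-surj cov v (f , tailS) (sym over)
            ... | (e , tailS) , refl , refl = e , value-injective (cong (f ,_) level-v)

            ends-surj-q : ∀ u d' → endV Lτ d' ≡ vm q u → ∃ λ d → (endV K d ≡ u) × (endMap q d ≡ d')
            ends-surj-q u d' at with ends-surj cov u (endMap ℓ d') (cong proj₁ (endV-value-≡ {d'} at))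
            ... | d , at-u , over = d , at-u , end-ext (trans (endMap-q d) over)
                    (trans (endGrp-q d) (trans (cong potential at-u) (sym (cong proj₂ (endV-value-≡ {d'} at)))))

          factorization : ∃ λ (q : Hom K Lτ) → IsCovering K Lτ q ×
                            (∀ v → vm r v ≡ vm ℓ (vm q v)) × (∀ e → em r e ≡ em ℓ (em q e))
          factorization = q , q-covering , (λ v → refl) , (λ e → refl)

        -- induced ℓ-covering (τ ∘ em ℓ) reduces to τ, since surjE of ℓ-covering picks an
        -- edge lying over f by construction.
        derived-minimal : LocalTension 𝔾 L τ → MinimalGlobalCoveringTension 𝔾 L Lτ ℓ (τ ∘ em ℓ)
        derived-minimal local = record
          { rotK    = Lτ-rotation
          ; connK   = Lτ-connected
          ; cov     = ℓ-covering
          ; global  = ℓ-global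
          ; fibre   = λ e e' same → cong τ same
          ; local   = local
          ; minimal = record
            { isGlobal  = record { rotK = Lτ-rotation ; connK = Lτ-connected ; cov = ℓ-covering ; global = ℓ-global }
            ; factorize = λ K r global-r → Lift.factorization global-r
            }
          }

  module _ {H D : Graph} (rotH : IsRot H) (dual : IsDual H D) where
    open IsDual dual

    flow⇒minimal-covering-tension :
      Finite Carrier → Finite (E H) → Connected H → (rotD : IsRot D) →
      (ψ : E H → Carrier) → IsFlow 𝔾 H ψ → (x : V D) →
      MinimalGlobalCoveringTension 𝔾 D (Derived.Lτ 𝔾 D rotD (ψ ∘ unstar) x) (Derived.ℓ 𝔾 D rotD (ψ ∘ unstar) x)
                                       (ψ ∘ unstar ∘ em (Derived.ℓ 𝔾 D rotD (ψ ∘ unstar) x))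
    flow⇒minimal-covering-tension finG finE connH rotD ψ flow x =
      DerivedGraph.derived-minimal rotD (ψ ∘ unstar) x (dual-connected dual rotH connH)
        (FiniteReach.Reach-recompute finG rotD (dual-edges-finite dual finE) (dual-end-at dual) (ψ ∘ unstar) x)
        (FlowDuality.flow⇒dual-local rotH dual (ψ ∘ unstar) ψ (cong ψ ∘ unstar-star) flow)

    minimal-covering-tension⇒flow : ∀ {K s φ} (m : MinimalGlobalCoveringTension 𝔾 D K s φ) →
                                    IsFlow 𝔾 H (induced 𝔾 (MinimalGlobalCoveringTension.cov m) φ ∘ star)
    minimal-covering-tension⇒flow m =
      FlowDuality.dual-local⇒flow rotH dual _ _ (λ _ → refl) (MinimalGlobalCoveringTension.local m)

theorem4p8 : (𝔾 : Grp) → Finite (Grp.Carrier 𝔾) →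
    (H : Graph) → IsRot H → Finite (V H) → Finite (E H) → Connected H →
    (D : Graph) (rotD : IsRot D) (dual : IsDual H D) →
    ((ψ : E H → Grp.Carrier 𝔾) → IsFlow 𝔾 H ψ → (x : V D) →
       MinimalGlobalCoveringTension 𝔾 D
         (Derived.Lτ 𝔾 D rotD (λ e → ψ (IsDual.unstar dual e)) x)
         (Derived.ℓ 𝔾 D rotD (λ e → ψ (IsDual.unstar dual e)) x)
         (λ e → ψ (IsDual.unstar dual (em (Derived.ℓ 𝔾 D rotD (λ e' → ψ (IsDual.unstar dual e')) x) e))))
    ×
    ((K : Graph) (s : Hom K D) (φ : E K → Grp.Carrier 𝔾) →
       (m : MinimalGlobalCoveringTension 𝔾 D K s φ) →
       IsFlow 𝔾 H (λ e → induced 𝔾 (MinimalGlobalCoveringTension.cov m) φ (IsDual.star dual e)))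
theorem4p8 𝔾 finG H rotH _ finE connH D rotD dual =
  flow⇒minimal-covering-tension 𝔾 rotH dual finG finE connH rotD ,
  λ K s φ → minimal-covering-tension⇒flow 𝔾 rotH dual
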